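{- Let $(U,\mathcal{S})$ be a laminar set system with laminar tree $T$ (so $L(T)=U$), and let $(A,B)$ be a bi-colouring of $L(T)$ identifying a subset $S$ of inner nodes of $T$. There exists a $\mathrm{CMSO}_2$-formula $\mathrm{repr}_{A,B}(a,X)$, over the vocabulary consisting of the unary set predicate $\mathsf{SET}$ (interpreted as $\mathcal{S}$) and unary relations $A$ and $B$ (interpreted as the sets $A,B$) on universe $U$, which is satisfied exactly when $X$ is an inner node of $T$ that belongs to $S$ and $a$ is the $A$-representative of $X$.
   Context: A set system is a pair $(U,\mathcal{S})$ with $U$ finite, $\emptyset\notin\mathcal{S}$, $U\in\mathcal{S}$, $\{a\}\in\mathcal{S}$ for all $a\in U$; it is laminar if no two members overlap (intersect with neither containing the other). Its laminar tree has the members of $\mathcal{S}$ as nodes, root $U$, and $S$ a child of $S'$ iff $S\subsetneq S'$ with no member strictly between; leaves are the singletons, identified with elements of $U$; inner nodes are thus members of $\mathcal{S}$ of size at least 2. $\mathrm{CMSO}_2$ is monadic second-order logic with a unary set predicate testing even cardinality. A bi-colouring is a pair $(A,B)$ of disjoint subsets of $L(T)$ of the same size. A pair $(\pi,\sigma)$ of injective maps from $S$ to $L(T)$ identifies $S$ if each $s\in S$ is the least common ancestor of $\pi(s)$ and $\sigma(s)$; a node $x$ is $s$-requested if it lies on the path from $\pi(s)$ to $\sigma(s)$; unique request means each node is $s$-requested for at most one $s$. $(A,B)$ identifies $S$ if some such pair with unique request has $\pi(S)=A$, $\sigma(S)=B$; this pair is then unique, and $\pi(s)$ is called the $A$-representative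 of $s\in S$. -}

module Defs where

open import Data.Nat using (ℕ; suc; _≤_)
open import Data.Nat.Divisibility using (_∣_)
open import Data.Bool using (Bool; T)
open import Data.Fin using (Fin)
open import Data.Fin.Subset as Sub
  using (Subset; _∈_; _∉_; _⊆_; ∣_∣; ⁅_⁆; Nonempty)
open import Data.Vec using (Vec; lookup; _∷_)
open import Data.Product using (Σ; ∃; ∃₂; _×_)
open import Data.Sum using (_⊎_)
open import Data.Empty using (⊥)
open import Relation.Nullary using (¬_)
open import Relation.Binary.PropositionalEquality using (_≡_)
open import Function.Bundles using (_⇔_)

record SetSystem (n : ℕ) : Set where
  field
    sets       : Subset n → Bool
    no-empty   : ¬ T (sets Sub.⊥)
    has-full   : T (sets Sub.⊤)
    has-singl  : ∀ (a : Fin n) → T (sets ⁅ a ⁆)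
open SetSystem public

Overlap : ∀ {n} → Subset n → Subset n → Set
Overlap X Y = Nonempty (X Sub.∩ Y) × ¬ (X ⊆ Y) × ¬ (Y ⊆ X)

Laminar : ∀ {n} → SetSystem n → Set
Laminar 𝒮 = ∀ X Y → T (sets 𝒮 X) → T (sets 𝒮 Y) → ¬ Overlap X Y

-- Laminar tree.  Nodes are the members of 𝒮; X is an ancestor of Y iff
-- Y ⊆ X; leaves are the singletons ⁅ a ⁆, identified with a ∈ U.

InnerNode : ∀ {n} → SetSystem n → Subset n → Set
InnerNode 𝒮 X = T (sets 𝒮 X) × 2 ≤ ∣ X ∣

IsLCA : ∀ {n} → SetSystem n → Subset n → Fin n → Fin n → Set
IsLCA 𝒮 X p q =
  T (sets 𝒮 X) × p ∈ X × q ∈ X ×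
  (∀ Y → T (sets 𝒮 Y) → p ∈ Y → q ∈ Y → X ⊆ Y)

BiColouring : ∀ {n} → Subset n → Subset n → Set
BiColouring A B = (∀ a → a ∈ A → a ∉ B) × ∣ A ∣ ≡ ∣ B ∣

InnerNodes : ∀ {n} → SetSystem n → (Subset n → Bool) → Set
InnerNodes 𝒮 S = ∀ X → T (S X) → InnerNode 𝒮 X

-- (π , σ) identifies S (π, σ given as total maps; only their
-- restriction to S matters).
record IdentPair {n} (𝒮 : SetSystem n) (S : Subset n → Bool)
                 (π σ : Subset n → Fin n) : Set where
  field
    π-inj : ∀ X Y → T (S X) → T (S Y) → π X ≡ π Y → X ≡ Y
    σ-inj : ∀ X Y → T (S X) → T (S Y) → σ X ≡ σ Y → X ≡ Y
    lca   : ∀ X → T (S X) → IsLCA 𝒮 X (π X) (σ X)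

-- The node x is s-requested: x lies on the tree path from π s to σ s,
-- i.e. x is a node below lca(π s, σ s) = s that is an ancestor of
-- π s or of σ s.
Requested : ∀ {n} → SetSystem n → (π σ : Subset n → Fin n) →
            Subset n → Subset n → Set
Requested 𝒮 π σ s x = T (sets 𝒮 x) × x ⊆ s × (π s ∈ x ⊎ σ s ∈ x)

UniqueRequest : ∀ {n} → SetSystem n → (Subset n → Bool) →
                (π σ : Subset n → Fin n) → Set
UniqueRequest 𝒮 S π σ = ∀ x s s' → T (S s) → T (S s') →
  Requested 𝒮 π σ s x → Requested 𝒮 π σ s' x → s ≡ s'

record IdentifiesVia {n} (𝒮 : SetSystem n) (A B : Subset n)
                     (S : Subset n → Bool) (π σ : Subset n → Fin n) : Set where
  field
    pair   : IdentPair 𝒮 S π σ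
    unique : UniqueRequest 𝒮 S π σ
    imgA   : ∀ a → a ∈ A ⇔ (∃ λ X → T (S X) × π X ≡ a)
    imgB   : ∀ b → b ∈ B ⇔ (∃ λ X → T (S X) × σ X ≡ b)

Identifies : ∀ {n} → SetSystem n → Subset n → Subset n →
             (Subset n → Bool) → Set
Identifies 𝒮 A B S = ∃₂ λ π σ → IdentifiesVia 𝒮 A B S π σ

-- a is the A-representative of X ∈ S (the identifying pair is unique).
IsARepr : ∀ {n} → SetSystem n → Subset n → Subset n →
          (Subset n → Bool) → Fin n → Subset n → Set
IsARepr 𝒮 A B S a X =
  ∃₂ λ π σ → IdentifiesVia 𝒮 A B S π σ × π X ≡ a

-- CMSO₂ over the vocabulary { SET (unary set predicate), A, B (unary
-- relations) }.  Formulas with e free element variables and s free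
-- set variables (de Bruijn indices).

data Formula : ℕ → ℕ → Set where
  _≐_    : ∀ {e s} → Fin e → Fin e → Formula e s
  _∈̇_    : ∀ {e s} → Fin e → Fin s → Formula e s
  SET    : ∀ {e s} → Fin s → Formula e s
  Rel-A  : ∀ {e s} → Fin e → Formula e s
  Rel-B  : ∀ {e s} → Fin e → Formula e s
  Even   : ∀ {e s} → Fin s → Formula e s
  ¬̇_     : ∀ {e s} → Formula e s → Formula e s
  _∧̇_    : ∀ {e s} → Formula e s → Formula e s → Formula e s
  ∃ₑ     : ∀ {e s} → Formula (suc e) s → Formula e s
  ∃ₛ     : ∀ {e s} → Formula e (suc s) → Formula e s

record Structure (n : ℕ) : Set where
  field
    SETᴵ : Subset n → Bool
    Aᴵ   : Subset n
    Bᴵ   : Subset n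

Sat : ∀ {n e s} → Structure n → Formula e s →
      Vec (Fin n) e → Vec (Subset n) s → Set
Sat 𝔄 (x ≐ y)   ρ τ = lookup ρ x ≡ lookup ρ y
Sat 𝔄 (x ∈̇ X)   ρ τ = lookup ρ x ∈ lookup τ X
Sat 𝔄 (SET X)   ρ τ = T (Structure.SETᴵ 𝔄 (lookup τ X))
Sat 𝔄 (Rel-A x) ρ τ = lookup ρ x ∈ Structure.Aᴵ 𝔄
Sat 𝔄 (Rel-B x) ρ τ = lookup ρ x ∈ Structure.Bᴵ 𝔄
Sat 𝔄 (Even X)  ρ τ = 2 ∣ ∣ lookup τ X ∣
Sat 𝔄 (¬̇ φ)     ρ τ = ¬ Sat 𝔄 φ ρ τ
Sat 𝔄 (φ ∧̇ ψ)   ρ τ = Sat 𝔄 φ ρ τ × Sat 𝔄 ψ ρ τ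
Sat 𝔄 (∃ₑ φ)    ρ τ = Σ _ λ a → Sat 𝔄 φ (a ∷ ρ) τ
Sat 𝔄 (∃ₛ φ)    ρ τ = Σ _ λ Y → Sat 𝔄 φ ρ (Y ∷ τ)

structure : ∀ {n} → SetSystem n → Subset n → Subset n → Structure n
structure 𝒮 A B = record { SETᴵ = sets 𝒮 ; Aᴵ = A ; Bᴵ = B }

{-# OPTIONS --safe #-}
-- Pairing π s with σ s for every s ∈ S gives a fixed-point-free involution
-- on A ∪ B (A and B are disjoint and π, σ injective).  If a member Y of the
-- laminar family is s-requested, then by laminarity every t ∈ S with an
-- endpoint in Y either lies below Y or has Y below it, and in the latter case
-- unique request forces t = s.  So s itself is closed under the involution and
-- |s ∩ (A ∪ B)| is even, whereas a member Y with π s ∈ Y ⊆ s and σ s ∉ Y is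
-- closed after removing π s, so |Y ∩ (A ∪ B)| is odd.  Consequently s is the
-- least member of 𝒮 that contains π s and meets A ∪ B evenly, a property
-- that CMSO₂ expresses with its Even predicate.
module Submission where

open import Defs
open import Data.Nat using (ℕ; suc; _+_; _<_)
open import Data.Nat.Properties using (+-comm; n<1+n; m<n⇒m<1+n)
open import Data.Nat.Induction using (<-wellFounded)
open import Data.Nat.Divisibility using (_∣_; _∣?_; _∣0; ∣-refl; ∣m∣n⇒∣m+n; ∣m+n∣m⇒∣n; ∣1⇒≡1)
open import Data.Bool using (Bool; T)
open import Data.Fin using (Fin; zero; suc)
open import Data.Fin.Properties using (any?; _≟_)
open import Data.Fin.Subset
  using (Subset; _∈_; _∉_; _⊆_; _∩_; _∪_; _─_; _-_; ∣_∣; ⁅_⁆; inside; outside)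
open import Data.Fin.Subset.Properties
  using (_∈?_; _⊆?_; ⊆-antisym; nonempty?; Empty-unique; ∣⊥∣≡0; p─⊥≡p; p─q⊆p;
         x∈p∩q⁺; x∈p∩q⁻; x∈p∪q⁺; x∈p∪q⁻; x∈p∧x≢y⇒x∈p-y; x∉⁅y⁆⇒x≢y; anySubset?)
open import Data.Vec using (Vec; lookup; _∷_; []; here; there)
open import Data.Product using (Σ; ∃; _×_; _,_; proj₁; proj₂)
open import Data.Sum using (_⊎_; inj₁; inj₂; [_,_])
open import Function using (id)
open import Function.Bundles using (_⇔_; mk⇔; Equivalence)
import Function.Properties.Equivalence as ⇔
open import Induction.WellFounded using (Acc; acc)
open import Relation.Nullary using (¬_; Dec; yes; no; contradiction)
open import Relation.Nullary.Decidable using (T?; ¬?; _×-dec_; decidable-stable)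
open import Relation.Binary.PropositionalEquality
  using (_≡_; _≢_; refl; sym; trans; cong; subst; module ≡-Reasoning)

∣p∣≡1+∣p-x∣ : ∀ {n} {x : Fin n} (p : Subset n) → x ∈ p → ∣ p ∣ ≡ suc ∣ p - x ∣
∣p∣≡1+∣p-x∣ (inside  ∷ p) here       = cong suc (sym (cong ∣_∣ (p─⊥≡p p)))
∣p∣≡1+∣p-x∣ (inside  ∷ p) (there x∈p) = cong suc (∣p∣≡1+∣p-x∣ p x∈p)
∣p∣≡1+∣p-x∣ (outside ∷ p) (there x∈p) = ∣p∣≡1+∣p-x∣ p x∈p

x∈p─q⇒x∉q : ∀ {n} {x : Fin n} (p q : Subset n) → x ∈ p ─ q → x ∉ q
x∈p─q⇒x∉q (_ ∷ p) (outside ∷ q) here        ()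
x∈p─q⇒x∉q (_ ∷ p) (_       ∷ q) (there x∈p─q) (there x∈q) = x∈p─q⇒x∉q p q x∈p─q x∈q

x∈p-y⇒x≢y : ∀ {n} {x y : Fin n} (p : Subset n) → x ∈ p - y → x ≢ y
x∈p-y⇒x≢y {y = y} p x∈p-y = x∉⁅y⁆⇒x≢y (x∈p─q⇒x∉q p ⁅ y ⁆ x∈p-y)

2∣n⇒2∤1+n : ∀ {n} → 2 ∣ n → ¬ (2 ∣ suc n)
2∣n⇒2∤1+n {n} 2∣n 2∣1+n with ∣1⇒≡1 (∣m+n∣m⇒∣n (subst (2 ∣_) (+-comm 1 n) 2∣1+n) 2∣n)
... | ()

record FreeInvolutionOn {n} (f : Fin n → Fin n) (P : Subset n) : Set where
  field
    closed      : ∀ {x} → x ∈ P → f x ∈ P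
    no-fixpoint : ∀ {x} → x ∈ P → f x ≢ x
    involutive  : ∀ {x} → x ∈ P → f (f x) ≡ x

module _ {n} {f : Fin n → Fin n} where

  remove-orbit : ∀ {P x} → FreeInvolutionOn f P → x ∈ P → FreeInvolutionOn f (P - x - f x)
  remove-orbit {P} {x} inv x∈P = record
    { closed      = λ z∈ → x∈p∧x≢y⇒x∈p-y (x∈p∧x≢y⇒x∈p-y (closed (∈P z∈)) (fz≢x z∈)) (fz≢fx z∈)
    ; no-fixpoint = λ z∈ → no-fixpoint (∈P z∈)
    ; involutive  = λ z∈ → involutive (∈P z∈)
    }
    where
    open FreeInvolutionOn inv
    ∈P-x : ∀ {z} → z ∈ P - x - f x → z ∈ P - x
    ∈P-x = p─q⊆p (P - x) ⁅ f x ⁆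
    ∈P : ∀ {z} → z ∈ P - x - f x → z ∈ P
    ∈P z∈ = p─q⊆p P ⁅ x ⁆ (∈P-x z∈)
    fz≢x : ∀ {z} → z ∈ P - x - f x → f z ≢ x
    fz≢x {z} z∈ fz≡x = x∈p-y⇒x≢y (P - x) z∈ (trans (sym (involutive (∈P z∈))) (cong f fz≡x))
    fz≢fx : ∀ {z} → z ∈ P - x - f x → f z ≢ f x
    fz≢fx {z} z∈ fz≡fx = x∈p-y⇒x≢y P (∈P-x z∈) (begin
      z         ≡⟨ involutive (∈P z∈) ⟨
      f (f z)   ≡⟨ cong f fz≡fx ⟩
      f (f x)   ≡⟨ involutive x∈P ⟩
      x         ∎)
      where open ≡-Reasoning

  involution⇒even : ∀ {P} → FreeInvolutionOn f P → 2 ∣ ∣ P ∣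
  involution⇒even {P} inv = go inv (<-wellFounded ∣ P ∣)
    where
    go : ∀ {P} → FreeInvolutionOn f P → Acc _<_ ∣ P ∣ → 2 ∣ ∣ P ∣
    go {P} inv (acc rec) with nonempty? P
    ... | no P-empty =
      subst (2 ∣_) (sym (trans (cong ∣_∣ (Empty-unique P-empty)) (∣⊥∣≡0 n))) (2 ∣0)
    ... | yes (x , x∈P) =
      subst (2 ∣_) (sym ∣P∣≡2+∣P'∣) (∣m∣n⇒∣m+n ∣-refl (go (remove-orbit inv x∈P) (rec ∣P'∣<∣P∣)))
      where
      open FreeInvolutionOn inv
      fx∈P-x : f x ∈ P - x
      fx∈P-x = x∈p∧x≢y⇒x∈p-y (closed x∈P) (no-fixpoint x∈P)
      ∣P∣≡2+∣P'∣ : ∣ P ∣ ≡ 2 + ∣ P - x - f x ∣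
      ∣P∣≡2+∣P'∣ = trans (∣p∣≡1+∣p-x∣ P x∈P) (cong suc (∣p∣≡1+∣p-x∣ (P - x) fx∈P-x))
      ∣P'∣<∣P∣ : ∣ P - x - f x ∣ < ∣ P ∣
      ∣P'∣<∣P∣ = subst (∣ P - x - f x ∣ <_) (sym ∣P∣≡2+∣P'∣) (m<n⇒m<1+n (n<1+n _))

laminar⇒comparable : ∀ {n} {𝒮 : SetSystem n} → Laminar 𝒮 → ∀ {X Y x} →
  T (sets 𝒮 X) → T (sets 𝒮 Y) → x ∈ X → x ∈ Y → X ⊆ Y ⊎ Y ⊆ X
laminar⇒comparable laminar {X} {Y} X∈𝒮 Y∈𝒮 x∈X x∈Y with X ⊆? Y | Y ⊆? X
... | yes X⊆Y | _       = inj₁ X⊆Y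
... | no _    | yes Y⊆X = inj₂ Y⊆X
... | no X⊈Y  | no Y⊈X  =
  contradiction ((_ , x∈p∩q⁺ (x∈X , x∈Y)) , X⊈Y , Y⊈X) (laminar X Y X∈𝒮 Y∈𝒮)

EvenlyColoured : ∀ {n} → Subset n → Subset n → Subset n → Set
EvenlyColoured A B Y = 2 ∣ ∣ Y ∩ (A ∪ B) ∣

record LeastEvenMember {n} (𝒮 : SetSystem n) (A B : Subset n) (a : Fin n) (X : Subset n)
       : Set where
  field
    member : T (sets 𝒮 X)
    a∈X    : a ∈ X
    a∈A    : a ∈ A
    even   : EvenlyColoured A B X
    least  : ∀ Y → T (sets 𝒮 Y) → a ∈ Y → EvenlyColoured A B Y → X ⊆ Y

module Identification {n} {𝒮 : SetSystem n} (laminar : Laminar 𝒮)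
  {A B : Subset n} (disjoint : ∀ x → x ∈ A → x ∉ B)
  {S : Subset n → Bool} {π σ : Subset n → Fin n} (ident : IdentifiesVia 𝒮 A B S π σ) where

  open IdentifiesVia ident
  open IdentPair pair

  S⊆𝒮 : ∀ {t} → T (S t) → T (sets 𝒮 t)
  S⊆𝒮 t∈S = proj₁ (lca _ t∈S)

  π∈ : ∀ {t} → T (S t) → π t ∈ t
  π∈ t∈S = proj₁ (proj₂ (lca _ t∈S))

  σ∈ : ∀ {t} → T (S t) → σ t ∈ t
  σ∈ t∈S = proj₁ (proj₂ (proj₂ (lca _ t∈S)))

  π∈A : ∀ {t} → T (S t) → π t ∈ A
  π∈A {t} t∈S = Equivalence.from (imgA (π t)) (t , t∈S , refl)

  σ∈B : ∀ {t} → T (S t) → σ t ∈ B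
  σ∈B {t} t∈S = Equivalence.from (imgB (σ t)) (t , t∈S , refl)

  Endpoint : Subset n → Fin n → Set
  Endpoint t x = π t ≡ x ⊎ σ t ≡ x

  endpoint : ∀ {x} → x ∈ A ∪ B → ∃ λ t → T (S t) × Endpoint t x
  endpoint {x} x∈A∪B with x∈p∪q⁻ A B x∈A∪B
  ... | inj₁ x∈A = let t , t∈S , πt≡x = Equivalence.to (imgA x) x∈A in t , t∈S , inj₁ πt≡x
  ... | inj₂ x∈B = let t , t∈S , σt≡x = Equivalence.to (imgB x) x∈B in t , t∈S , inj₂ σt≡x

  endpoint∈ : ∀ {t x} → T (S t) → Endpoint t x → x ∈ t
  endpoint∈ t∈S (inj₁ refl) = π∈ t∈S
  endpoint∈ t∈S (inj₂ refl) = σ∈ t∈S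

  endpoint∈A∪B : ∀ {t x} → T (S t) → Endpoint t x → x ∈ A ∪ B
  endpoint∈A∪B t∈S (inj₁ refl) = x∈p∪q⁺ (inj₁ (π∈A t∈S))
  endpoint∈A∪B t∈S (inj₂ refl) = x∈p∪q⁺ (inj₂ (σ∈B t∈S))

  endpoint∈⇒end∈ : ∀ {t x Y} → Endpoint t x → x ∈ Y → π t ∈ Y ⊎ σ t ∈ Y
  endpoint∈⇒end∈ (inj₁ refl) x∈Y = inj₁ x∈Y
  endpoint∈⇒end∈ (inj₂ refl) x∈Y = inj₂ x∈Y

  partner : Fin n → Fin n
  partner x with x ∈? A | x ∈? B
  ... | yes x∈A | _       = σ (proj₁ (Equivalence.to (imgA x) x∈A))
  ... | no _    | yes x∈B = π (proj₁ (Equivalence.to (imgB x) x∈B))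
  ... | no _    | no _    = x

  partner-π : ∀ {t} → T (S t) → partner (π t) ≡ σ t
  partner-π {t} t∈S with π t ∈? A | π t ∈? B
  ... | no πt∉A | _ = contradiction (π∈A t∈S) πt∉A
  ... | yes πt∈A | _ with Equivalence.to (imgA (π t)) πt∈A
  ...   | t′ , t′∈S , πt′≡πt = cong σ (π-inj t′ t t′∈S t∈S πt′≡πt)

  partner-σ : ∀ {t} → T (S t) → partner (σ t) ≡ π t
  partner-σ {t} t∈S with σ t ∈? A | σ t ∈? B
  ... | yes σt∈A | _       = contradiction (σ∈B t∈S) (disjoint _ σt∈A)
  ... | no _     | no σt∉B = contradiction (σ∈B t∈S) σt∉B
  ... | no _     | yes σt∈B with Equivalence.to (imgB (σ t)) σt∈B
  ...   | t′ , t′∈S , σt′≡σt = cong π (σ-inj t′ t t′∈S t∈S σt′≡σt)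

  partner-endpoint : ∀ {t x} → T (S t) → Endpoint t x → Endpoint t (partner x)
  partner-endpoint t∈S (inj₁ refl) = inj₂ (sym (partner-π t∈S))
  partner-endpoint t∈S (inj₂ refl) = inj₁ (sym (partner-σ t∈S))

  partner∈A∪B : ∀ {x} → x ∈ A ∪ B → partner x ∈ A ∪ B
  partner∈A∪B x∈A∪B =
    let t , t∈S , x-end = endpoint x∈A∪B in endpoint∈A∪B t∈S (partner-endpoint t∈S x-end)

  partner-involutive : ∀ {x} → x ∈ A ∪ B → partner (partner x) ≡ x
  partner-involutive x∈A∪B with endpoint x∈A∪B
  ... | t , t∈S , inj₁ refl = trans (cong partner (partner-π t∈S)) (partner-σ t∈S)
  ... | t , t∈S , inj₂ refl = trans (cong partner (partner-σ t∈S)) (partner-π t∈S)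

  partner-no-fixpoint : ∀ {x} → x ∈ A ∪ B → partner x ≢ x
  partner-no-fixpoint x∈A∪B with endpoint x∈A∪B
  ... | t , t∈S , inj₁ refl = λ e →
    disjoint _ (π∈A t∈S) (subst (_∈ B) (trans (sym (partner-π t∈S)) e) (σ∈B t∈S))
  ... | t , t∈S , inj₂ refl = λ e →
    disjoint _ (subst (_∈ A) (trans (sym (partner-σ t∈S)) e) (π∈A t∈S)) (σ∈B t∈S)

  partner-freeInvolutionOn : ∀ {P} → (∀ {x} → x ∈ P → x ∈ A ∪ B) →
    (∀ {x} → x ∈ P → partner x ∈ P) → FreeInvolutionOn partner P
  partner-freeInvolutionOn P⊆A∪B closed = record
    { closed      = closed
    ; no-fixpoint = λ x∈P → partner-no-fixpoint (P⊆A∪B x∈P)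
    ; involutive  = λ x∈P → partner-involutive (P⊆A∪B x∈P)
    }

  self-requested : ∀ {s} → T (S s) → Requested 𝒮 π σ s s
  self-requested s∈S = S⊆𝒮 s∈S , id , inj₁ (π∈ s∈S)

  partner-stays : ∀ {s Y x} → T (S s) → Requested 𝒮 π σ s Y → x ∈ Y → x ∈ A ∪ B →
    partner x ∈ Y ⊎ Endpoint s x
  partner-stays {s} {Y} {x} s∈S Y-req@(Y∈𝒮 , _ , _) x∈Y x∈A∪B with endpoint x∈A∪B
  ... | t , t∈S , x-end
    with laminar⇒comparable {𝒮 = 𝒮} laminar (S⊆𝒮 t∈S) Y∈𝒮 (endpoint∈ t∈S x-end) x∈Y
  ... | inj₁ t⊆Y = inj₁ (t⊆Y (endpoint∈ t∈S (partner-endpoint t∈S x-end)))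
  ... | inj₂ Y⊆t = inj₂ (subst (λ u → Endpoint u x) (sym s≡t) x-end)
    where
    s≡t : s ≡ t
    s≡t = unique Y s t s∈S t∈S Y-req (Y∈𝒮 , Y⊆t , endpoint∈⇒end∈ x-end x∈Y)

  identified⇒evenlyColoured : ∀ {s} → T (S s) → EvenlyColoured A B s
  identified⇒evenlyColoured {s} s∈S =
    involution⇒even (partner-freeInvolutionOn (λ x∈ → proj₂ (x∈p∩q⁻ s (A ∪ B) x∈)) closed)
    where
    closed : ∀ {x} → x ∈ s ∩ (A ∪ B) → partner x ∈ s ∩ (A ∪ B)
    closed x∈ with x∈p∩q⁻ s (A ∪ B) x∈
    ... | x∈s , x∈A∪B = x∈p∩q⁺ (px∈s , partner∈A∪B x∈A∪B)
      where
      px∈s = [ id , (λ x-end → endpoint∈ s∈S (partner-endpoint s∈S x-end)) ]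
               (partner-stays s∈S (self-requested s∈S) x∈s x∈A∪B)

  separating⇒¬evenlyColoured : ∀ {s Y} → T (S s) → T (sets 𝒮 Y) → Y ⊆ s →
    π s ∈ Y → σ s ∉ Y → ¬ EvenlyColoured A B Y
  separating⇒¬evenlyColoured {s} {Y} s∈S Y∈𝒮 Y⊆s πs∈Y σs∉Y even =
    2∣n⇒2∤1+n (involution⇒even (partner-freeInvolutionOn (λ x∈ → proj₂ (∈C x∈)) closed))
              (subst (2 ∣_) (∣p∣≡1+∣p-x∣ C πs∈C) even)
    where
    C = Y ∩ (A ∪ B)
    πs∈C : π s ∈ C
    πs∈C = x∈p∩q⁺ (πs∈Y , x∈p∪q⁺ (inj₁ (π∈A s∈S)))
    ∈C : ∀ {x} → x ∈ C - π s → x ∈ Y × x ∈ A ∪ B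
    ∈C x∈ = x∈p∩q⁻ Y (A ∪ B) (p─q⊆p C ⁅ π s ⁆ x∈)
    closed : ∀ {x} → x ∈ C - π s → partner x ∈ C - π s
    closed {x} x∈ with ∈C x∈
    ... | x∈Y , x∈A∪B with partner-stays s∈S (Y∈𝒮 , Y⊆s , inj₁ πs∈Y) x∈Y x∈A∪B
    ... | inj₁ px∈Y = x∈p∧x≢y⇒x∈p-y (x∈p∩q⁺ (px∈Y , partner∈A∪B x∈A∪B)) px≢πs
      where
      px≢πs : partner x ≢ π s
      px≢πs px≡πs = σs∉Y (subst (_∈ Y) x≡σs x∈Y)
        where
        open ≡-Reasoning
        x≡σs : x ≡ σ s
        x≡σs = begin
          x                   ≡⟨ partner-involutive x∈A∪B ⟨
          partner (partner x) ≡⟨ cong partner px≡πs ⟩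
          partner (π s)       ≡⟨ partner-π s∈S ⟩
          σ s                 ∎
    ... | inj₂ (inj₁ πs≡x) = contradiction (sym πs≡x) (x∈p-y⇒x≢y C x∈)
    ... | inj₂ (inj₂ σs≡x) = contradiction (subst (_∈ Y) (sym σs≡x) x∈Y) σs∉Y

  π∈evenlyColoured⇒⊆ : ∀ {s Y} → T (S s) → T (sets 𝒮 Y) → π s ∈ Y →
    EvenlyColoured A B Y → s ⊆ Y
  π∈evenlyColoured⇒⊆ {s} {Y} s∈S Y∈𝒮 πs∈Y even
    with laminar⇒comparable {𝒮 = 𝒮} laminar (S⊆𝒮 s∈S) Y∈𝒮 (π∈ s∈S) πs∈Y
  ... | inj₁ s⊆Y = s⊆Y
  ... | inj₂ Y⊆s with σ s ∈? Y
  ...   | yes σs∈Y = proj₂ (proj₂ (proj₂ (lca s s∈S))) Y Y∈𝒮 πs∈Y σs∈Y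
  ...   | no σs∉Y  = contradiction even (separating⇒¬evenlyColoured s∈S Y∈𝒮 Y⊆s πs∈Y σs∉Y)

  leastEvenMember⇔identified : ∀ {a X} → LeastEvenMember 𝒮 A B a X ⇔ (T (S X) × π X ≡ a)
  leastEvenMember⇔identified {a} {X} = mk⇔ to from
    where
    to : LeastEvenMember 𝒮 A B a X → T (S X) × π X ≡ a
    to m with Equivalence.to (imgA a) (LeastEvenMember.a∈A m)
    ... | s , s∈S , refl = subst (λ Z → T (S Z)) (sym X≡s) s∈S , cong π X≡s
      where
      open LeastEvenMember m
      X≡s : X ≡ s
      X≡s = ⊆-antisym (least s (S⊆𝒮 s∈S) (π∈ s∈S) (identified⇒evenlyColoured s∈S))
                      (π∈evenlyColoured⇒⊆ s∈S member a∈X even)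
    from : T (S X) × π X ≡ a → LeastEvenMember 𝒮 A B a X
    from (X∈S , refl) = record
      { member = S⊆𝒮 X∈S
      ; a∈X    = π∈ X∈S
      ; a∈A    = π∈A X∈S
      ; even   = identified⇒evenlyColoured X∈S
      ; least  = λ Y Y∈𝒮 → π∈evenlyColoured⇒⊆ X∈S Y∈𝒮
      }

-- Decidability lets the connectives ⇒̇, ∨̇, ∀ₑ, ∀ₛ below, defined through ¬̇,
-- be read classically.
sat? : ∀ {n e s} (𝔄 : Structure n) (φ : Formula e s) ρ τ → Dec (Sat 𝔄 φ ρ τ)
sat? 𝔄 (x ≐ y)   ρ τ = lookup ρ x ≟ lookup ρ y
sat? 𝔄 (x ∈̇ X)   ρ τ = lookup ρ x ∈? lookup τ X
sat? 𝔄 (SET X)   ρ τ = T? (Structure.SETᴵ 𝔄 (lookup τ X))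
sat? 𝔄 (Rel-A x) ρ τ = lookup ρ x ∈? Structure.Aᴵ 𝔄
sat? 𝔄 (Rel-B x) ρ τ = lookup ρ x ∈? Structure.Bᴵ 𝔄
sat? 𝔄 (Even X)  ρ τ = 2 ∣? ∣ lookup τ X ∣
sat? 𝔄 (¬̇ φ)     ρ τ = ¬? (sat? 𝔄 φ ρ τ)
sat? 𝔄 (φ ∧̇ ψ)   ρ τ = sat? 𝔄 φ ρ τ ×-dec sat? 𝔄 ψ ρ τ
sat? 𝔄 (∃ₑ φ)    ρ τ = any? λ a → sat? 𝔄 φ (a ∷ ρ) τ
sat? 𝔄 (∃ₛ φ)    ρ τ = anySubset? λ Y → sat? 𝔄 φ ρ (Y ∷ τ)

infixr 6 _⇒̇_ _⇔̇_
infixr 7 _∨̇_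

_⇒̇_ : ∀ {e s} → Formula e s → Formula e s → Formula e s
φ ⇒̇ ψ = ¬̇ (φ ∧̇ (¬̇ ψ))

_∨̇_ : ∀ {e s} → Formula e s → Formula e s → Formula e s
φ ∨̇ ψ = ¬̇ ((¬̇ φ) ∧̇ (¬̇ ψ))

_⇔̇_ : ∀ {e s} → Formula e s → Formula e s → Formula e s
φ ⇔̇ ψ = (φ ⇒̇ ψ) ∧̇ (ψ ⇒̇ φ)

∀ₑ : ∀ {e s} → Formula (suc e) s → Formula e s
∀ₑ φ = ¬̇ (∃ₑ (¬̇ φ))

∀ₛ : ∀ {e s} → Formula e (suc s) → Formula e s
∀ₛ φ = ¬̇ (∃ₛ (¬̇ φ))

_⊆̇_ : ∀ {e s} → Fin s → Fin s → Formula e s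
X ⊆̇ Y = ∀ₑ ((zero ∈̇ X) ⇒̇ (zero ∈̇ Y))

evenlyColouredᶠ : ∀ {e s} → Fin s → Formula e s
evenlyColouredᶠ Y =
  ∃ₛ (Even zero ∧̇ ∀ₑ ((zero ∈̇ zero) ⇔̇ ((zero ∈̇ suc Y) ∧̇ (Rel-A zero ∨̇ Rel-B zero))))

repr : Formula 1 1
repr = SET zero ∧̇ ((zero ∈̇ zero) ∧̇ (Rel-A zero ∧̇ (evenlyColouredᶠ zero ∧̇
       ∀ₛ ((SET zero ∧̇ ((zero ∈̇ zero) ∧̇ evenlyColouredᶠ zero)) ⇒̇ (suc zero ⊆̇ zero)))))

module _ {n} (𝔄 : Structure n) where
  private variable
    e s : ℕ
    ρ : Vec (Fin n) e
    τ : Vec (Subset n) s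

  sat-⇒̇ : (φ ψ : Formula e s) → Sat 𝔄 (φ ⇒̇ ψ) ρ τ ⇔ (Sat 𝔄 φ ρ τ → Sat 𝔄 ψ ρ τ)
  sat-⇒̇ φ ψ = mk⇔
    (λ ¬[φ∧¬ψ] φ-holds → decidable-stable (sat? 𝔄 ψ _ _) (λ ¬ψ → ¬[φ∧¬ψ] (φ-holds , ¬ψ)))
    (λ φ→ψ (φ-holds , ¬ψ) → ¬ψ (φ→ψ φ-holds))

  sat-∨̇ : (φ ψ : Formula e s) → Sat 𝔄 (φ ∨̇ ψ) ρ τ ⇔ (Sat 𝔄 φ ρ τ ⊎ Sat 𝔄 ψ ρ τ)
  sat-∨̇ {ρ = ρ} {τ = τ} φ ψ = mk⇔ to (λ φ⊎ψ (¬φ , ¬ψ) → [ ¬φ , ¬ψ ] φ⊎ψ)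
    where
    to : Sat 𝔄 (φ ∨̇ ψ) ρ τ → Sat 𝔄 φ ρ τ ⊎ Sat 𝔄 ψ ρ τ
    to ¬[¬φ∧¬ψ] with sat? 𝔄 φ ρ τ
    ... | yes φ-holds = inj₁ φ-holds
    ... | no ¬φ = inj₂ (decidable-stable (sat? 𝔄 ψ _ _) (λ ¬ψ → ¬[¬φ∧¬ψ] (¬φ , ¬ψ)))

  sat-⇔̇ : (φ ψ : Formula e s) → Sat 𝔄 (φ ⇔̇ ψ) ρ τ ⇔ (Sat 𝔄 φ ρ τ ⇔ Sat 𝔄 ψ ρ τ)
  sat-⇔̇ φ ψ = mk⇔
    (λ (φ⇒ψ , ψ⇒φ) → mk⇔ (Equivalence.to (sat-⇒̇ φ ψ) φ⇒ψ) (Equivalence.to (sat-⇒̇ ψ φ) ψ⇒φ))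
    (λ φ⇔ψ → Equivalence.from (sat-⇒̇ φ ψ) (Equivalence.to φ⇔ψ) ,
             Equivalence.from (sat-⇒̇ ψ φ) (Equivalence.from φ⇔ψ))

  sat-∀ₑ : (φ : Formula (suc e) s) → Sat 𝔄 (∀ₑ φ) ρ τ ⇔ (∀ a → Sat 𝔄 φ (a ∷ ρ) τ)
  sat-∀ₑ φ = mk⇔
    (λ ¬∃¬φ a → decidable-stable (sat? 𝔄 φ _ _) (λ ¬φ → ¬∃¬φ (a , ¬φ)))
    (λ ∀φ (a , ¬φ) → ¬φ (∀φ a))

  sat-∀ₛ : (φ : Formula e (suc s)) → Sat 𝔄 (∀ₛ φ) ρ τ ⇔ (∀ Y → Sat 𝔄 φ ρ (Y ∷ τ))
  sat-∀ₛ φ = mk⇔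
    (λ ¬∃¬φ Y → decidable-stable (sat? 𝔄 φ _ _) (λ ¬φ → ¬∃¬φ (Y , ¬φ)))
    (λ ∀φ (Y , ¬φ) → ¬φ (∀φ Y))

  sat-⊆̇ : (X Y : Fin s) → Sat 𝔄 (X ⊆̇ Y) ρ τ ⇔ lookup τ X ⊆ lookup τ Y
  sat-⊆̇ {τ = τ} X Y = mk⇔
    (λ sat {x} x∈X → decidable-stable (x ∈? lookup τ Y)
                       λ x∉Y → sat (x , λ ¬[x∈X∧x∉Y] → ¬[x∈X∧x∉Y] (x∈X , x∉Y)))
    (λ X⊆Y (x , ¬¬[x∈X∧x∉Y]) → ¬¬[x∈X∧x∉Y] λ (x∈X , x∉Y) → x∉Y (X⊆Y x∈X))

  sat-coloured : ∀ {x Z} (Y : Fin s) →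
    Sat 𝔄 ((zero ∈̇ suc Y) ∧̇ (Rel-A zero ∨̇ Rel-B zero)) (x ∷ ρ) (Z ∷ τ)
      ⇔ x ∈ lookup τ Y ∩ (Structure.Aᴵ 𝔄 ∪ Structure.Bᴵ 𝔄)
  sat-coloured {ρ = ρ} {τ = τ} {x} {Z} Y = mk⇔
    (λ (x∈Y , x∈A∨B) → x∈p∩q⁺ (x∈Y , x∈p∪q⁺ (Equivalence.to A∨B⇔ x∈A∨B)))
    (λ x∈ → let x∈Y , x∈A∪B = x∈p∩q⁻ _ _ x∈ in x∈Y , Equivalence.from A∨B⇔ (x∈p∪q⁻ _ _ x∈A∪B))
    where
    A∨B⇔ = sat-∨̇ {ρ = x ∷ ρ} {τ = Z ∷ τ} (Rel-A zero) (Rel-B zero)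

  sat-evenlyColouredᶠ : (Y : Fin s) →
    Sat 𝔄 (evenlyColouredᶠ Y) ρ τ ⇔ EvenlyColoured (Structure.Aᴵ 𝔄) (Structure.Bᴵ 𝔄) (lookup τ Y)
  sat-evenlyColouredᶠ {ρ = ρ} {τ = τ} Y = mk⇔ to from
    where
    open Structure 𝔄
    C = lookup τ Y ∩ (Aᴵ ∪ Bᴵ)
    φ-coloured = (zero ∈̇ suc Y) ∧̇ (Rel-A zero ∨̇ Rel-B zero)
    sat-defines : ∀ Z → Sat 𝔄 (∀ₑ ((zero ∈̇ zero) ⇔̇ φ-coloured)) ρ (Z ∷ τ) ⇔ (∀ x → x ∈ Z ⇔ x ∈ C)
    sat-defines Z = mk⇔
      (λ sat x → ⇔.trans (Equivalence.to (sat-⇔̇-at x) (Equivalence.to sat-∀ sat x))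
                         (sat-coloured-at x))
      (λ Z-def → Equivalence.from sat-∀ λ x →
                   Equivalence.from (sat-⇔̇-at x) (⇔.trans (Z-def x) (⇔.sym (sat-coloured-at x))))
      where
      sat-∀ = sat-∀ₑ {ρ = ρ} {τ = Z ∷ τ} ((zero ∈̇ zero) ⇔̇ φ-coloured)
      sat-⇔̇-at = λ x → sat-⇔̇ {ρ = x ∷ ρ} {τ = Z ∷ τ} (zero ∈̇ zero) φ-coloured
      sat-coloured-at = λ x → sat-coloured {ρ = ρ} {τ = τ} {x} {Z} Y
    to : Sat 𝔄 (evenlyColouredᶠ Y) ρ τ → EvenlyColoured Aᴵ Bᴵ (lookup τ Y)
    to (Z , 2∣∣Z∣ , Z-sat) = subst (λ W → 2 ∣ ∣ W ∣) (⊆-antisym Z⊆C C⊆Z) 2∣∣Z∣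
      where
      Z-def = Equivalence.to (sat-defines Z) Z-sat
      Z⊆C : Z ⊆ C
      Z⊆C {x} = Equivalence.to (Z-def x)
      C⊆Z : C ⊆ Z
      C⊆Z {x} = Equivalence.from (Z-def x)
    from : EvenlyColoured Aᴵ Bᴵ (lookup τ Y) → Sat 𝔄 (evenlyColouredᶠ Y) ρ τ
    from even = C , even , Equivalence.from (sat-defines C) (λ _ → ⇔.refl)

sat-repr : ∀ {n} {𝒮 : SetSystem n} {A B : Subset n} {a X} →
  Sat (structure 𝒮 A B) repr (a ∷ []) (X ∷ []) ⇔ LeastEvenMember 𝒮 A B a X
sat-repr {n} {𝒮} {A} {B} {a} {X} = mk⇔
  (λ (X∈𝒮 , a∈X , a∈A , even , least) → record
    { member = X∈𝒮 ; a∈X = a∈X ; a∈A = a∈A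
    ; even   = Equivalence.to (sat-even [] X) even
    ; least  = Equivalence.to sat-least least
    })
  (λ m → let open LeastEvenMember m in
    member , a∈X , a∈A , Equivalence.from (sat-even [] X) even , Equivalence.from sat-least least)
  where
  𝔄 = structure 𝒮 A B
  sat-even : ∀ {s} (τ : Vec (Subset n) s) Y →
    Sat 𝔄 (evenlyColouredᶠ zero) (a ∷ []) (Y ∷ τ) ⇔ EvenlyColoured A B Y
  sat-even τ Y = sat-evenlyColouredᶠ 𝔄 {ρ = a ∷ []} {τ = Y ∷ τ} zero
  candidate : Formula 1 2
  candidate = SET zero ∧̇ ((zero ∈̇ zero) ∧̇ evenlyColouredᶠ zero)
  Least : Set
  Least = ∀ Y → T (sets 𝒮 Y) → a ∈ Y → EvenlyColoured A B Y → X ⊆ Y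
  sat-least : Sat 𝔄 (∀ₛ (candidate ⇒̇ (suc zero ⊆̇ zero))) (a ∷ []) (X ∷ []) ⇔ Least
  sat-least = mk⇔ to from
    where
    sat-∀ = sat-∀ₛ 𝔄 {ρ = a ∷ []} {τ = X ∷ []} (candidate ⇒̇ (suc zero ⊆̇ zero))
    sat-⇒-at = λ Y → sat-⇒̇ 𝔄 {ρ = a ∷ []} {τ = Y ∷ X ∷ []} candidate (suc zero ⊆̇ zero)
    sat-⊆-at = λ Y → sat-⊆̇ 𝔄 {ρ = a ∷ []} {τ = Y ∷ X ∷ []} (suc zero) zero
    to : Sat 𝔄 (∀ₛ (candidate ⇒̇ (suc zero ⊆̇ zero))) (a ∷ []) (X ∷ []) → Least
    to sat Y Y∈𝒮 a∈Y even = Equivalence.to (sat-⊆-at Y)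
      (Equivalence.to (sat-⇒-at Y) (Equivalence.to sat-∀ sat Y)
        (Y∈𝒮 , a∈Y , Equivalence.from (sat-even (X ∷ []) Y) even))
    from : Least → Sat 𝔄 (∀ₛ (candidate ⇒̇ (suc zero ⊆̇ zero))) (a ∷ []) (X ∷ [])
    from least = Equivalence.from sat-∀ λ Y → Equivalence.from (sat-⇒-at Y)
      λ (Y∈𝒮 , a∈Y , even) → Equivalence.from (sat-⊆-at Y)
        (least Y Y∈𝒮 a∈Y (Equivalence.to (sat-even (X ∷ []) Y) even))

lemma3p11 : Σ (Formula 1 1) λ repr →
    ∀ (n : ℕ) (𝒮 : SetSystem n) → Laminar 𝒮 →
    (A B : Subset n) → BiColouring A B →
    (S : Subset n → Bool) → InnerNodes 𝒮 S → Identifies 𝒮 A B S →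
    ∀ (a : Fin n) (X : Subset n) →
      Sat (structure 𝒮 A B) repr (a ∷ []) (X ∷ [])
        ⇔ (InnerNode 𝒮 X × T (S X) × IsARepr 𝒮 A B S a X)
lemma3p11 = repr , λ n 𝒮 laminar A B (disjoint , _) S inner (π , σ , ident) a X → mk⇔
  (λ sat →
    let X∈S , πX≡a = Equivalence.to (characterisation laminar disjoint ident)
                                    (Equivalence.to sat-repr sat)
    in inner X X∈S , X∈S , π , σ , ident , πX≡a)
  (λ (_ , X∈S , π′ , σ′ , ident′ , π′X≡a) →
    Equivalence.from sat-repr
      (Equivalence.from (characterisation laminar disjoint ident′) (X∈S , π′X≡a)))
  where
  open Identification using () renaming (leastEvenMember⇔identified to characterisation)
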